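{- Let $G$ be a finite simple connected graph with no induced $P_5$ and no induced $K_1+(K_1\cup K_3)$. Suppose $G$ has an induced 5-cycle $C=v_1v_2v_3v_4v_5v_1$ (indices modulo 5) and has no clique cut set, and let $T$ be a component of $G[N^2(C)]$. Then: (a) for each $i\in\{1,\dots,5\}$, $G[N(v_i)]$ is $(K_1\cup K_3)$-free, $G[N_{\{i,i+2\}}(C)]$ is $K_3$-free, and $N_{\{i,i+1,i+2\}}(C)\cup N_{\{i,i+1,i+3\}}(C)\cup N_{\{i,i+1,i+2,i+3\}}(C)$ is an independent set; (b) if no vertex of $N(C)$ is adjacent to every vertex of $T$, then there exist two non-adjacent vertices $u,v\in N(C)$ such that both $N_T(u)$ and $N_T(v)$ are nonempty.
   Context: $K_1+(K_1\cup K_3)$ is the join of a single vertex with the disjoint union of a vertex and a triangle. For $X\subseteq V(G)$, $N^i(X)$ is the set of vertices not in $X$ at distance exactly $i$ from $X$, $N(X)=N^1(X)$, and $N_X(v)$ is the set of neighbours of $v$ in $X$. For $S\subseteq\{1,\dots,5\}$, $N_S(C)$ is the set of vertices $x\in N(C)$ such that $xv_i\in E(G)$ if and only if $i\in S$. A clique cut set is a clique whose removal disconnects $G$. -}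

module Defs where

open import Data.Nat using (ℕ; _≡ᵇ_; _<ᵇ_; _+_; ∣_-_∣)
open import Data.Nat.DivMod using (_mod_)
open import Data.Bool using (Bool; true; false; not; _∧_; _∨_)
open import Data.Fin using (Fin; toℕ)
open import Data.Fin.Subset using (Subset; _∈_; _∉_)
open import Data.List using (List; _∷_; [])
import Data.List.Membership.Propositional as LM
open import Data.Product using (Σ; ∃; _×_; _,_)
open import Data.Unit using (⊤)
open import Relation.Binary.PropositionalEquality using (_≡_; _≢_)
open import Relation.Nullary using (¬_)
open import Function.Definitions using (Injective)
open import Function.Bundles using (_⇔_)

record Graph : Set where
  field
    n     : ℕ
    adj   : Fin n → Fin n → Bool
    sym   : ∀ x y → adj x y ≡ adj y x
    irrfl : ∀ x → adj x x ≡ false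

module _ (G : Graph) where
  open Graph G

  _~_ : Fin n → Fin n → Set
  x ~ y = adj x y ≡ true

  -- walks all of whose vertices satisfy P (i.e. walks in G[P])
  data PathIn (P : Fin n → Set) : Fin n → Fin n → Set where
    here : ∀ {x} → P x → PathIn P x x
    step : ∀ {x y z} → P x → x ~ y → PathIn P y z → PathIn P x z

  Connected : Set
  Connected = ∀ x y → PathIn (λ _ → ⊤) x y

  HasInducedIn : (Fin n → Set) → (k : ℕ) → (Fin k → Fin k → Bool) → Set
  HasInducedIn P k h =
    Σ (Fin k → Fin n) λ f →
      Injective _≡_ _≡_ f × (∀ i → P (f i)) × (∀ i j → adj (f i) (f j) ≡ h i j)

  HasInduced : (k : ℕ) → (Fin k → Fin k → Bool) → Set
  HasInduced = HasInducedIn (λ _ → ⊤)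

  IsCliqueCutSet : Subset n → Set
  IsCliqueCutSet K =
    (∀ x y → x ∈ K → y ∈ K → x ≢ y → x ~ y) ×
    (Σ (Fin n) λ x → Σ (Fin n) λ y →
       x ∉ K × y ∉ K × ¬ PathIn (λ z → z ∉ K) x y)

  HasCliqueCutSet : Set
  HasCliqueCutSet = Σ (Subset n) IsCliqueCutSet

  Nbr : Fin n → Fin n → Set
  Nbr v x = x ~ v

  IndependentSet : (Fin n → Set) → Set
  IndependentSet P = ∀ x y → P x → P y → ¬ (x ~ y)

  module _ (v : Fin 5 → Fin n) where
    InC : Fin n → Set
    InC x = Σ (Fin 5) λ j → x ≡ v j

    N1 : Fin n → Set
    N1 x = ¬ InC x × Σ (Fin 5) λ j → x ~ v j

    N2 : Fin n → Set
    N2 x = ¬ InC x × (∀ j → ¬ (x ~ v j)) × Σ (Fin n) λ y → N1 y × x ~ y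

    NS : List (Fin 5) → Fin n → Set
    NS S x = N1 x × (∀ j → (x ~ v j) ⇔ (j LM.∈ S))

_⊕_ : Fin 5 → ℕ → Fin 5
i ⊕ k = (toℕ i + k) mod 5

P5 : Fin 5 → Fin 5 → Bool
P5 i j = ∣ toℕ i - toℕ j ∣ ≡ᵇ 1

C5 : Fin 5 → Fin 5 → Bool
C5 i j = (∣ toℕ i - toℕ j ∣ ≡ᵇ 1) ∨ (∣ toℕ i - toℕ j ∣ ≡ᵇ 4)

-- K1 + (K1 ∪ K3): vertex 0 joined to all; vertex 1 isolated otherwise;
-- vertices 2,3,4 form a triangle
K1+K1∪K3 : Fin 5 → Fin 5 → Bool
K1+K1∪K3 i j = not (toℕ i ≡ᵇ toℕ j) ∧
  ((toℕ i ≡ᵇ 0) ∨ (toℕ j ≡ᵇ 0) ∨ ((1 <ᵇ toℕ i) ∧ (1 <ᵇ toℕ j)))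

K1∪K3 : Fin 4 → Fin 4 → Bool
K1∪K3 i j = not (toℕ i ≡ᵇ toℕ j) ∧ (0 <ᵇ toℕ i) ∧ (0 <ᵇ toℕ j)

K3 : Fin 3 → Fin 3 → Bool
K3 i j = not (toℕ i ≡ᵇ toℕ j)

{-# OPTIONS --safe #-}
-- Every forbidden configuration here is a vertex c together with an induced
-- K₁ ∪ K₃ in N(c).  For (a), take c = vᵢ with the isolated vertex v_{i-1}:
-- a triangle in N_{i,i+2}(C), or an edge xy with x, y adjacent to vᵢ, v_{i+1}
-- but not v_{i-1} (completed to the triangle x y v_{i+1}), would give one.
-- For (b), a vertex of N(C) mixed on an edge ab of T is complete to C, since
-- otherwise v_{j+1} vⱼ x a b is an induced P₅.  Take u ∈ N(C) adjacent to
-- T; it is mixed on some edge ab of T, and b has a neighbour w ∈ N(C).  If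
-- u ~ w then w is mixed on an edge of T as well, and w with the isolated
-- vertex b and the triangle u v₀ v₁ is a K₁ + (K₁ ∪ K₃).
module Submission where

open import Defs
open import Data.Bool using (Bool; true; false)
open import Data.Bool.Properties using (¬-not) renaming (_≟_ to _≟ᵇ_)
open import Data.Empty using (⊥-elim)
open import Data.Fin using (Fin; zero; suc; _≟_)
open import Data.Fin.Properties using (any?; all?)
open import Data.List using (List; []; _∷_; filter; length; allFin)
open import Data.List.Membership.Propositional using (_∈_; _∉_)
open import Data.List.Membership.Propositional.Properties using (∈-filter⁺; ∈-filter⁻; ∈-allFin)
open import Data.List.Properties using (filter-notAll)
open import Data.List.Relation.Unary.All using (All; []; _∷_)
import Data.List.Relation.Unary.All as All
open import Data.List.Relation.Unary.All.Properties using (All¬⇒¬Any)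
open import Data.List.Relation.Unary.Any using (here; there)
import Data.List.Relation.Unary.Any as Any
open import Data.Nat using (zero; suc; _≤_)
open import Data.Nat.Properties using (≤-refl; ≤-trans; <-≤-trans; n≮0; ≤-pred)
open import Data.Product using (Σ; _×_; _,_; proj₁; proj₂)
open import Data.Sum using (_⊎_; inj₁; inj₂)
open import Function using (_∘_)
open import Function.Bundles using (Equivalence)
open import Function.Definitions using (Injective)
open import Relation.Binary.PropositionalEquality
  using (_≡_; _≢_; refl; sym; trans; cong; module ≡-Reasoning)
open import Relation.Nullary using (¬_; Dec; yes; no; ¬?; contradiction)
open import Relation.Nullary.Decidable using (toWitness; map′; _×-dec_; _⊎-dec_)
open import Relation.Unary using (Decidable)

Separating : ∀ {k} → (Fin k → Fin k → Bool) → Set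
Separating {k} h = ∀ i j → i ≡ j ⊎ h i j ≡ true ⊎ Σ (Fin k) λ l → h i l ≢ h j l

separating? : ∀ {k} (h : Fin k → Fin k → Bool) → Dec (Separating h)
separating? h = all? λ i → all? λ j →
  (i ≟ j) ⊎-dec (h i j ≟ᵇ true) ⊎-dec any? (λ l → ¬? (h i l ≟ᵇ h j l))

P5-separating : Separating P5
P5-separating = toWitness {a? = separating? P5} _

K1∪K3-separating : Separating K1∪K3
K1∪K3-separating = toWitness {a? = separating? K1∪K3} _

K1+K1∪K3-separating : Separating K1+K1∪K3
K1+K1∪K3-separating = toWitness {a? = separating? K1+K1∪K3} _

C5-⊕1 : ∀ i → C5 i (i ⊕ 1) ≡ true
C5-⊕1 = toWitness {a? = all? λ i → C5 i (i ⊕ 1) ≟ᵇ true} _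

C5-⊕4 : ∀ i → C5 i (i ⊕ 4) ≡ true
C5-⊕4 = toWitness {a? = all? λ i → C5 i (i ⊕ 4) ≟ᵇ true} _

C5-⊕4-⊕1 : ∀ i → C5 (i ⊕ 4) (i ⊕ 1) ≡ false
C5-⊕4-⊕1 = toWitness {a? = all? λ i → C5 (i ⊕ 4) (i ⊕ 1) ≟ᵇ false} _

⊕4-distinct : ∀ i → All (i ⊕ 4 ≢_) (i ∷ i ⊕ 1 ∷ i ⊕ 2 ∷ i ⊕ 3 ∷ [])
⊕4-distinct = toWitness {a? = all? λ i →
  All.all? (λ j → ¬? (i ⊕ 4 ≟ j)) (i ∷ i ⊕ 1 ∷ i ⊕ 2 ∷ i ⊕ 3 ∷ [])} _

⊕1-closed⇒all : ∀ {P : Fin 5 → Set} → (∀ j → P j → P (j ⊕ 1)) → ∀ {j} → P j → ∀ k → P k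
⊕1-closed⇒all {P} next {j} pj k = from0 (to0 j pj) k
  where
  to0 : ∀ j → P j → P zero
  to0 zero                             p = p
  to0 (suc zero)                       p = next _ (next _ (next _ (next _ p)))
  to0 (suc (suc zero))                 p = next _ (next _ (next _ p))
  to0 (suc (suc (suc zero)))           p = next _ (next _ p)
  to0 (suc (suc (suc (suc zero))))     p = next _ p
  from0 : P zero → ∀ k → P k
  from0 p zero                         = p
  from0 p (suc zero)                   = next _ p
  from0 p (suc (suc zero))             = next _ (next _ p)
  from0 p (suc (suc (suc zero)))       = next _ (next _ (next _ p))
  from0 p (suc (suc (suc (suc zero)))) = next _ (next _ (next _ (next _ p)))

module _ (G : Graph) where
  open Graph G using (n; adj; irrfl)

  adj-sym : ∀ {x y b} → adj x y ≡ b → adj y x ≡ b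
  adj-sym {x} {y} e = trans (Graph.sym G y x) e

  separating⇒injective : ∀ {k} {h : Fin k → Fin k → Bool} → Separating h →
    (f : Fin k → Fin n) → (∀ i j → adj (f i) (f j) ≡ h i j) → Injective _≡_ _≡_ f
  separating⇒injective {h = h} sep f ad {i} {j} fi≡fj with sep i j
  ... | inj₁ i≡j = i≡j
  ... | inj₂ (inj₁ hij) = contradiction
    (begin
      false           ≡⟨ sym (irrfl (f j)) ⟩
      adj (f j) (f j) ≡⟨ cong (λ z → adj z (f j)) (sym fi≡fj) ⟩
      adj (f i) (f j) ≡⟨ ad i j ⟩
      h i j           ≡⟨ hij ⟩
      true            ∎) λ ()
    where open ≡-Reasoning
  ... | inj₂ (inj₂ (l , hil≢hjl)) = contradiction
    (begin
      h i l           ≡⟨ sym (ad i l) ⟩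
      adj (f i) (f l) ≡⟨ cong (λ z → adj z (f l)) fi≡fj ⟩
      adj (f j) (f l) ≡⟨ ad j l ⟩
      h j l           ∎) hil≢hjl
    where open ≡-Reasoning

  realise : ∀ {k P} (h : Fin k → Fin k → Bool) → Separating h → (f : Fin k → Fin n) →
    (∀ i → P (f i)) → (∀ i j → adj (f i) (f j) ≡ h i j) → HasInducedIn G P k h
  realise h sep f inP ad = f , separating⇒injective sep f ad , inP , ad

  inducedP5 : ∀ {a b c d e} →
    adj a b ≡ true → adj b c ≡ true → adj c d ≡ true → adj d e ≡ true →
    adj a c ≡ false → adj a d ≡ false → adj a e ≡ false →
    adj b d ≡ false → adj b e ≡ false → adj c e ≡ false → HasInduced G 5 P5
  inducedP5 {a} {b} {c} {d} {e} ab bc cd de ac ad ae bd be ce =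
    realise P5 P5-separating f (λ _ → _) matches
    where
    f : Fin 5 → Fin n
    f zero                         = a
    f (suc zero)                   = b
    f (suc (suc zero))             = c
    f (suc (suc (suc zero)))       = d
    f (suc (suc (suc (suc zero)))) = e
    matches : ∀ i j → adj (f i) (f j) ≡ P5 i j
    matches zero                         zero                         = irrfl a
    matches zero                         (suc zero)                   = ab
    matches zero                         (suc (suc zero))             = ac
    matches zero                         (suc (suc (suc zero)))       = ad
    matches zero                         (suc (suc (suc (suc zero)))) = ae
    matches (suc zero)                   zero                         = adj-sym ab
    matches (suc zero)                   (suc zero)                   = irrfl b
    matches (suc zero)                   (suc (suc zero))             = bc
    matches (suc zero)                   (suc (suc (suc zero)))       = bd
    matches (suc zero)                   (suc (suc (suc (suc zero)))) = be
    matches (suc (suc zero))             zero                         = adj-sym ac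
    matches (suc (suc zero))             (suc zero)                   = adj-sym bc
    matches (suc (suc zero))             (suc (suc zero))             = irrfl c
    matches (suc (suc zero))             (suc (suc (suc zero)))       = cd
    matches (suc (suc zero))             (suc (suc (suc (suc zero)))) = ce
    matches (suc (suc (suc zero)))       zero                         = adj-sym ad
    matches (suc (suc (suc zero)))       (suc zero)                   = adj-sym bd
    matches (suc (suc (suc zero)))       (suc (suc zero))             = adj-sym cd
    matches (suc (suc (suc zero)))       (suc (suc (suc zero)))       = irrfl d
    matches (suc (suc (suc zero)))       (suc (suc (suc (suc zero)))) = de
    matches (suc (suc (suc (suc zero)))) zero                         = adj-sym ae
    matches (suc (suc (suc (suc zero)))) (suc zero)                   = adj-sym be
    matches (suc (suc (suc (suc zero)))) (suc (suc zero))             = adj-sym ce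
    matches (suc (suc (suc (suc zero)))) (suc (suc (suc zero)))       = adj-sym de
    matches (suc (suc (suc (suc zero)))) (suc (suc (suc (suc zero)))) = irrfl e

  inducedK1∪K3 : ∀ {P : Fin n → Set} {d p q r} → P d → P p → P q → P r →
    adj d p ≡ false → adj d q ≡ false → adj d r ≡ false →
    adj p q ≡ true → adj p r ≡ true → adj q r ≡ true → HasInducedIn G P 4 K1∪K3
  inducedK1∪K3 {P} {d} {p} {q} {r} Pd Pp Pq Pr dp dq dr pq pr qr =
    realise {P = P} K1∪K3 K1∪K3-separating f inP matches
    where
    f : Fin 4 → Fin n
    f zero                   = d
    f (suc zero)             = p
    f (suc (suc zero))       = q
    f (suc (suc (suc zero))) = r
    inP : ∀ i → P (f i)
    inP zero                   = Pd
    inP (suc zero)             = Pp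
    inP (suc (suc zero))       = Pq
    inP (suc (suc (suc zero))) = Pr
    matches : ∀ i j → adj (f i) (f j) ≡ K1∪K3 i j
    matches zero                   zero                   = irrfl d
    matches zero                   (suc zero)             = dp
    matches zero                   (suc (suc zero))       = dq
    matches zero                   (suc (suc (suc zero))) = dr
    matches (suc zero)             zero                   = adj-sym dp
    matches (suc zero)             (suc zero)             = irrfl p
    matches (suc zero)             (suc (suc zero))       = pq
    matches (suc zero)             (suc (suc (suc zero))) = pr
    matches (suc (suc zero))       zero                   = adj-sym dq
    matches (suc (suc zero))       (suc zero)             = adj-sym pq
    matches (suc (suc zero))       (suc (suc zero))       = irrfl q
    matches (suc (suc zero))       (suc (suc (suc zero))) = qr
    matches (suc (suc (suc zero))) zero                   = adj-sym dr
    matches (suc (suc (suc zero))) (suc zero)             = adj-sym pr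
    matches (suc (suc (suc zero))) (suc (suc zero))       = adj-sym qr
    matches (suc (suc (suc zero))) (suc (suc (suc zero))) = irrfl r

  cone-K1∪K3 : ∀ c → HasInducedIn G (Nbr G c) 4 K1∪K3 → HasInduced G 5 K1+K1∪K3
  cone-K1∪K3 c (f , _ , f~c , ad) = realise K1+K1∪K3 K1+K1∪K3-separating g (λ _ → _) matches
    where
    g : Fin 5 → Fin n
    g zero    = c
    g (suc i) = f i
    matches : ∀ i j → adj (g i) (g j) ≡ K1+K1∪K3 i j
    matches zero    zero    = irrfl c
    matches zero    (suc j) = adj-sym (f~c j)
    matches (suc i) zero    = f~c i
    matches (suc i) (suc j) = ad i j

  PathIn-head : ∀ {P x y} → PathIn G P x y → P x
  PathIn-head (here px)     = px
  PathIn-head (step px _ _) = px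

  PathIn-last : ∀ {P x y} → PathIn G P x y → P y
  PathIn-last (here py)    = py
  PathIn-last (step _ _ p) = PathIn-last p

  PathIn-map : ∀ {P Q : Fin n → Set} → (∀ {z} → P z → Q z) →
    ∀ {x y} → PathIn G P x y → PathIn G Q x y
  PathIn-map f (here px)     = here (f px)
  PathIn-map f (step px e p) = step (f px) e (PathIn-map f p)

  PathIn-snoc : ∀ {P x y z} → PathIn G P x y → adj y z ≡ true → P z → PathIn G P x z
  PathIn-snoc (here py)     e pz = step py e (here pz)
  PathIn-snoc (step px e p) f pz = step px e (PathIn-snoc p f pz)

  PathIn-component : ∀ {P t y} → PathIn G P t y → PathIn G (PathIn G P t) t y
  PathIn-component p = go (here (PathIn-head p)) p
    where
    go : ∀ {P t s y} → PathIn G P t s → PathIn G P s y → PathIn G (PathIn G P t) s y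
    go prefix (here _)     = here prefix
    go prefix (step _ e p) = step prefix e (go (PathIn-snoc prefix e (PathIn-head p)) p)

  private
    _─_ : List (Fin n) → Fin n → List (Fin n)
    L ─ x = filter (λ z → ¬? (z ≟ x)) L

    ─-⊆ : ∀ {L x z} → z ∈ L ─ x → z ∈ L
    ─-⊆ {L} z∈ = proj₁ (∈-filter⁻ (λ z → ¬? (z ≟ _)) {xs = L} z∈)

    ─-shorter : ∀ {L x} → x ∈ L → suc (length (L ─ x)) ≤ length L
    ─-shorter {L} x∈L =
      filter-notAll (λ z → ¬? (z ≟ _)) L (Any.map (λ { refl x≢x → x≢x refl }) x∈L)

    -- Cut the walk after its last visit to x.
    leave : ∀ {L x a y} → PathIn G (_∈ L) a y → x ≢ y →
      PathIn G (_∈ L ─ x) a y ⊎ Σ (Fin n) λ z → adj x z ≡ true × PathIn G (_∈ L ─ x) z y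
    leave (here a∈L) x≢a = inj₁ (here (∈-filter⁺ (λ z → ¬? (z ≟ _)) a∈L (x≢a ∘ sym)))
    leave {x = x} (step {a} {b} a∈L e p) x≢y with leave p x≢y | a ≟ x
    ... | inj₂ exit  | _        = inj₂ exit
    ... | inj₁ p'    | yes refl = inj₂ (b , e , p')
    ... | inj₁ p'    | no a≢x   = inj₁ (step (∈-filter⁺ (λ z → ¬? (z ≟ _)) a∈L a≢x) e p')

    PathIn-∈? : ∀ k L → length L ≤ k → ∀ x y → Dec (PathIn G (_∈ L) x y)
    PathIn-∈? k L len x y with Any.any? (x ≟_) L | x ≟ y
    ... | no x∉L | _        = no (x∉L ∘ PathIn-head)
    ... | yes x∈L | yes refl = yes (here x∈L)
    PathIn-∈? zero    L len x y | yes x∈L | no _ = ⊥-elim (n≮0 (<-≤-trans (─-shorter x∈L) len))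
    PathIn-∈? (suc k) L len x y | yes x∈L | no x≢y =
      map′ (λ (z , x~z , p) → step x∈L x~z (PathIn-map ─-⊆ p)) exit
        (any? λ z → (adj x z ≟ᵇ true) ×-dec
                    PathIn-∈? k (L ─ x) (≤-pred (≤-trans (─-shorter x∈L) len)) z y)
      where
      exit : PathIn G (_∈ L) x y → Σ (Fin n) λ z → adj x z ≡ true × PathIn G (_∈ L ─ x) z y
      exit p with leave p x≢y
      ... | inj₁ q = ⊥-elim (proj₂ (∈-filter⁻ (λ z → ¬? (z ≟ x)) {xs = L} (PathIn-head q)) refl)
      ... | inj₂ r = r

  PathIn? : ∀ {P} → Decidable P → ∀ x y → Dec (PathIn G P x y)
  PathIn? {P} P? x y =
    map′ (PathIn-map (proj₂ ∘ ∈-filter⁻ P? {xs = allFin n}))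
         (PathIn-map (λ {z} → ∈-filter⁺ P? (∈-allFin z)))
         (PathIn-∈? _ (filter P? (allFin n)) ≤-refl x y)

  MixedEdge : (Fin n → Set) → Fin n → Set
  MixedEdge Q x = Σ (Fin n) λ a → Σ (Fin n) λ b →
    Q a × Q b × adj a b ≡ true × adj x a ≡ true × adj x b ≡ false

  MixedEdge-map : ∀ {Q R x} → (∀ {z} → Q z → R z) → MixedEdge Q x → MixedEdge R x
  MixedEdge-map f (a , b , Qa , Qb , ab , xa , xb) = a , b , f Qa , f Qb , ab , xa , xb

  PathIn-mixed : ∀ {Q s y} x → PathIn G Q s y → adj x s ≢ adj x y → MixedEdge Q x
  PathIn-mixed x (here _) differs = contradiction refl differs
  PathIn-mixed {s = s} x (step {y = s'} Qs e p) differs with adj x s ≟ᵇ adj x s'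
  ... | yes same = PathIn-mixed x p (differs ∘ trans same)
  ... | no  diff = orient (adj x s) (adj x s') refl refl diff
    where
    orient : ∀ b b' → adj x s ≡ b → adj x s' ≡ b' → b ≢ b' → MixedEdge _ x
    orient true  true  _  _   b≢b' = contradiction refl b≢b'
    orient false false _  _   b≢b' = contradiction refl b≢b'
    orient true  false xs xs' _    = s , s' , Qs , PathIn-head p , e , xs , xs'
    orient false true  xs xs' _    = s' , s , PathIn-head p , Qs , adj-sym e , xs' , xs

  nbr-K1∪K3-free : ¬ HasInduced G 5 K1+K1∪K3 → ∀ c → ¬ HasInducedIn G (Nbr G c) 4 K1∪K3
  nbr-K1∪K3-free noK c = noK ∘ cone-K1∪K3 c

  module _ (v : Fin 5 → Fin n) where

    NS-adj : ∀ {S x j} → NS G v S x → j ∈ S → adj x (v j) ≡ true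
    NS-adj (_ , iff) j∈S = Equivalence.from (iff _) j∈S

    NS-nonadj : ∀ {S x j} → NS G v S x → j ∉ S → adj x (v j) ≡ false
    NS-nonadj (_ , iff) j∉S = ¬-not (j∉S ∘ Equivalence.to (iff _))

    N2-nonadj : ∀ {x} → N2 G v x → ∀ j → adj x (v j) ≡ false
    N2-nonadj (_ , x≁C , _) j = ¬-not (x≁C j)

    InC? : Decidable (InC G v)
    InC? x = any? λ j → x ≟ v j

    N1? : Decidable (N1 G v)
    N1? x = ¬? (InC? x) ×-dec any? (λ j → adj x (v j) ≟ᵇ true)

    N2? : Decidable (N2 G v)
    N2? x = ¬? (InC? x) ×-dec all? (λ j → ¬? (adj x (v j) ≟ᵇ true))
                       ×-dec any? (λ y → N1? y ×-dec (adj x y ≟ᵇ true))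

    Component : Fin n → Fin n → Set
    Component t = PathIn G (N2 G v) t

    AdjEdgeNotPrev : Fin 5 → Fin n → Set
    AdjEdgeNotPrev i x = adj x (v i) ≡ true × adj x (v (i ⊕ 1)) ≡ true × adj x (v (i ⊕ 4)) ≡ false

    NS-AdjEdgeNotPrev : ∀ i x →
      NS G v (i ∷ (i ⊕ 1) ∷ (i ⊕ 2) ∷ []) x ⊎
      NS G v (i ∷ (i ⊕ 1) ∷ (i ⊕ 3) ∷ []) x ⊎
      NS G v (i ∷ (i ⊕ 1) ∷ (i ⊕ 2) ∷ (i ⊕ 3) ∷ []) x → AdjEdgeNotPrev i x
    NS-AdjEdgeNotPrev i x nsx with ⊕4-distinct i | nsx
    ... | d₀ ∷ d₁ ∷ d₂ ∷ d₃ ∷ [] | inj₁ ns =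
      NS-adj ns (here refl) , NS-adj ns (there (here refl)) , NS-nonadj ns (All¬⇒¬Any (d₀ ∷ d₁ ∷ d₂ ∷ []))
    ... | d₀ ∷ d₁ ∷ d₂ ∷ d₃ ∷ [] | inj₂ (inj₁ ns) =
      NS-adj ns (here refl) , NS-adj ns (there (here refl)) , NS-nonadj ns (All¬⇒¬Any (d₀ ∷ d₁ ∷ d₃ ∷ []))
    ... | ds                    | inj₂ (inj₂ ns) =
      NS-adj ns (here refl) , NS-adj ns (there (here refl)) , NS-nonadj ns (All¬⇒¬Any ds)

    module _ (t : Fin n)
             (noneComplete : ¬ (Σ (Fin n) λ x → N1 G v x × (∀ y → Component t y → adj x y ≡ true))) where

      -- Membership in the component is decidable, which turns "x is not complete
      -- to it" into an explicit non-neighbour.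
      nonNeighbour : ∀ {x} → N1 G v x → Σ (Fin n) λ y → Component t y × adj x y ≡ false
      nonNeighbour {x} x∈N1 with any? (λ y → PathIn? N2? t y ×-dec (adj x y ≟ᵇ false))
      ... | yes r    = r
      ... | no  none =
        ⊥-elim (noneComplete (x , x∈N1 , λ y Ty → ¬-not (λ x≁y → none (y , Ty , x≁y))))

      -- Walk from t to whichever of s, y x treats differently from t.
      mixedOnComponent : ∀ {x s} → N1 G v x → Component t s → adj x s ≡ true → MixedEdge (Component t) x
      mixedOnComponent {x} {s} x∈N1 Ts xs with nonNeighbour x∈N1
      ... | y , Ty , xy with adj x t ≟ᵇ adj x y
      ... | no  t≢y = PathIn-mixed x (PathIn-component Ty) t≢y
      ... | yes t≡y = PathIn-mixed x (PathIn-component Ts) λ t≡s →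
        contradiction (trans (sym xy) (trans (sym t≡y) (trans t≡s xs))) λ ()

    module _ (vC : ∀ i j → adj (v i) (v j) ≡ C5 i j) where

      cycle-adj : ∀ {b} i j → C5 i j ≡ b → adj (v i) (v j) ≡ b
      cycle-adj i j = trans (vC i j)

      module _ (noK : ¬ HasInduced G 5 K1+K1∪K3) where

        NS-K3-free : ∀ i → ¬ HasInducedIn G (NS G v (i ∷ (i ⊕ 2) ∷ [])) 3 K3
        NS-K3-free i (f , _ , inS , ad) with ⊕4-distinct i
        ... | i₄≢i ∷ _ ∷ i₄≢i₂ ∷ _ =
          nbr-K1∪K3-free noK (v i) (inducedK1∪K3 {P = Nbr G (v i)}
            (adj-sym (cycle-adj i (i ⊕ 4) (C5-⊕4 i)))
            (sees zero) (sees (suc zero)) (sees (suc (suc zero)))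
            (misses zero) (misses (suc zero)) (misses (suc (suc zero)))
            (ad zero (suc zero)) (ad zero (suc (suc zero))) (ad (suc zero) (suc (suc zero))))
          where
          sees : ∀ k → adj (f k) (v i) ≡ true
          sees k = NS-adj (inS k) (here refl)
          misses : ∀ k → adj (v (i ⊕ 4)) (f k) ≡ false
          misses k = adj-sym (NS-nonadj (inS k) (All¬⇒¬Any (i₄≢i ∷ i₄≢i₂ ∷ [])))

        AdjEdgeNotPrev-independent : ∀ i x y →
          AdjEdgeNotPrev i x → AdjEdgeNotPrev i y → ¬ adj x y ≡ true
        AdjEdgeNotPrev-independent i x y (x₀ , x₁ , x₄) (y₀ , y₁ , y₄) xy =
          nbr-K1∪K3-free noK (v i) (inducedK1∪K3 {P = Nbr G (v i)}
            (adj-sym (cycle-adj i (i ⊕ 4) (C5-⊕4 i))) x₀ y₀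
            (adj-sym (cycle-adj i (i ⊕ 1) (C5-⊕1 i)))
            (adj-sym x₄) (adj-sym y₄) (cycle-adj (i ⊕ 4) (i ⊕ 1) (C5-⊕4-⊕1 i))
            xy x₁ y₁)

        complete-edge⇒¬private-neighbour : ∀ {u w b} →
          (∀ j → adj u (v j) ≡ true) → (∀ j → adj w (v j) ≡ true) → N2 G v b →
          adj u w ≡ true → adj w b ≡ true → ¬ adj u b ≡ false
        complete-edge⇒¬private-neighbour u-C w-C b∈N2 uw wb ub =
          nbr-K1∪K3-free noK _ (inducedK1∪K3 {P = Nbr G _} (adj-sym wb) uw
            (adj-sym (w-C zero)) (adj-sym (w-C (suc zero)))
            (adj-sym ub) (N2-nonadj b∈N2 zero) (N2-nonadj b∈N2 (suc zero))
            (u-C zero) (u-C (suc zero)) (cycle-adj zero (suc zero) refl))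

      module _ (noP5 : ¬ HasInduced G 5 P5) where

        mixed⇒complete : ∀ {x} → N1 G v x → MixedEdge (N2 G v) x → ∀ j → adj x (v j) ≡ true
        mixed⇒complete {x} (_ , j , xj) (a , b , a∈N2 , b∈N2 , ab , xa , xb) = ⊕1-closed⇒all next xj
          where
          next : ∀ j → adj x (v j) ≡ true → adj x (v (j ⊕ 1)) ≡ true
          next j xj with adj x (v (j ⊕ 1)) ≟ᵇ true
          ... | yes xj₁  = xj₁
          ... | no  x≁j₁ = ⊥-elim (noP5 (inducedP5
                (adj-sym (cycle-adj j (j ⊕ 1) (C5-⊕1 j))) (adj-sym xj) xa ab
                (adj-sym (¬-not x≁j₁)) (adj-sym (N2-nonadj a∈N2 _)) (adj-sym (N2-nonadj b∈N2 _))
                (adj-sym (N2-nonadj a∈N2 _)) (adj-sym (N2-nonadj b∈N2 _)) xb))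

        module _ (noK : ¬ HasInduced G 5 K1+K1∪K3) (t : Fin n) (t∈N2 : N2 G v t)
                 (noneComplete : ¬ (Σ (Fin n) λ x → N1 G v x × (∀ y → Component t y → adj x y ≡ true)))
                 where

          mixedOnComponent⇒complete : ∀ {x s} → N1 G v x → Component t s → adj x s ≡ true →
            ∀ j → adj x (v j) ≡ true
          mixedOnComponent⇒complete x∈N1 Ts xs =
            mixed⇒complete x∈N1 (MixedEdge-map PathIn-last (mixedOnComponent t noneComplete x∈N1 Ts xs))

          twoNonAdjacentAttachments : Σ (Fin n) λ u → Σ (Fin n) λ w →
            N1 G v u × N1 G v w × u ≢ w × ¬ adj u w ≡ true ×
            (Σ (Fin n) λ y → Component t y × adj u y ≡ true) ×
            (Σ (Fin n) λ y → Component t y × adj w y ≡ true)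
          twoNonAdjacentAttachments with proj₂ (proj₂ t∈N2)
          ... | u , u∈N1 , tu with mixedOnComponent t noneComplete u∈N1 (here t∈N2) (adj-sym tu)
          ... | _ , b , _ , Tb , _ , _ , u≁b with PathIn-last Tb
          ... | b∈N2@(_ , _ , w , w∈N1 , bw) with adj u w ≟ᵇ true
          ... | no  u≁w =
            u , w , u∈N1 , w∈N1 , u≢w , u≁w , (t , here t∈N2 , adj-sym tu) , (b , Tb , adj-sym bw)
            where
            u≢w : u ≢ w
            u≢w refl = contradiction (trans (sym u≁b) (adj-sym bw)) λ ()
          ... | yes u~w = ⊥-elim (complete-edge⇒¬private-neighbour noK
              (mixedOnComponent⇒complete u∈N1 (here t∈N2) (adj-sym tu))
              (mixedOnComponent⇒complete w∈N1 Tb (adj-sym bw))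
              b∈N2 u~w (adj-sym bw) u≁b)

lemma6p3 : (G : Graph) → Connected G → ¬ HasInduced G 5 P5 → ¬ HasInduced G 5 K1+K1∪K3 →
    (v : Fin 5 → Fin (Graph.n G)) → Injective _≡_ _≡_ v →
    (∀ i j → Graph.adj G (v i) (v j) ≡ C5 i j) →
    ¬ HasCliqueCutSet G →
    (t : Fin (Graph.n G)) → N2 G v t →
    ((∀ i →
        ¬ HasInducedIn G (Nbr G (v i)) 4 K1∪K3 ×
        ¬ HasInducedIn G (NS G v (i ∷ (i ⊕ 2) ∷ [])) 3 K3 ×
        IndependentSet G (λ x →
          NS G v (i ∷ (i ⊕ 1) ∷ (i ⊕ 2) ∷ []) x ⊎
          NS G v (i ∷ (i ⊕ 1) ∷ (i ⊕ 3) ∷ []) x ⊎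
          NS G v (i ∷ (i ⊕ 1) ∷ (i ⊕ 2) ∷ (i ⊕ 3) ∷ []) x))
     ×
     (¬ (Σ (Fin (Graph.n G)) λ x → N1 G v x ×
           (∀ y → PathIn G (N2 G v) t y → _~_ G x y)) →
      Σ (Fin (Graph.n G)) λ u → Σ (Fin (Graph.n G)) λ w →
        N1 G v u × N1 G v w × u ≢ w × ¬ (_~_ G u w) ×
        (Σ (Fin (Graph.n G)) λ y → PathIn G (N2 G v) t y × _~_ G u y) ×
        (Σ (Fin (Graph.n G)) λ y → PathIn G (N2 G v) t y × _~_ G w y)))
lemma6p3 G _ noP5 noK v _ vC _ t t∈N2 =
  (λ i → nbr-K1∪K3-free G noK (v i)
       , NS-K3-free G v vC noK i
       , λ x y x∈ y∈ → AdjEdgeNotPrev-independent G v vC noK i x y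
                         (NS-AdjEdgeNotPrev G v i x x∈) (NS-AdjEdgeNotPrev G v i y y∈))
  , twoNonAdjacentAttachments G v vC noP5 noK t t∈N2
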